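{- Let $s$ be a finite rooted ordered labeled tree in which every node has at most a left child and at most a right child, and let $X=\mathrm{XML}(s)$ with positions $1,\dots,|X|$. Let $1\le i\le j\le |X|$. Then there is at most one closing tag $\bar a$ of a node $a$ that is a left child, with parent node $p$, such that $$\mathrm{pos}(p) < i \le \mathrm{pos}(\bar a) \le j < \mathrm{pos}(\bar p).$$
   Context: For each label there is an opening tag and a closing tag; $\mathrm{XML}(s)$ is the sequence of tags of a depth-first left-to-right traversal of $s$ (left child before right child), writing a node's opening tag when entering it and its closing tag when leaving it. For a node $v$, $\mathrm{pos}(v)$ and $\mathrm{pos}(\bar v)$ denote the positions in $X$ of the opening and of the closing tag of $v$, respectively. (In the paper $s=\mathrm{FCNS}(t)$ is the First-Child-Next-Sibling encoding of a tree $t$, where left children correspond to first children in $t$ and right children to next siblings.) -}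

module Defs where

open import Data.Nat using (ℕ; zero; suc)
open import Data.List using (List; []; _∷_; _++_; _∷ʳ_; [_])
open import Data.Maybe using (Maybe; just; nothing)
open import Data.Product using (Σ)
open import Relation.Binary.PropositionalEquality using (_≡_)

data Tree (A : Set) : Set where
  leaf : Tree A
  node : A → Tree A → Tree A → Tree A

-- A node of a tree is identified by its path from the root.
data Dir : Set where
  L R : Dir

Path : Set
Path = List Dir

data Tag (A : Set) : Set where
  opn : Path → A → Tag A
  cls : Path → A → Tag A

XMLat : {A : Set} → Path → Tree A → List (Tag A)
XMLat π leaf = []
XMLat π (node x l r) = opn π x ∷ (XMLat (π ∷ʳ L) l ++ (XMLat (π ∷ʳ R) r ++ [ cls π x ]))

XML : {A : Set} → Tree A → List (Tag A)
XML = XMLat []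

-- 1-based lookup in a list.
at : {B : Set} → List B → ℕ → Maybe B
at [] _ = nothing
at (x ∷ xs) zero = nothing
at (x ∷ xs) (suc zero) = just x
at (x ∷ xs) (suc (suc k)) = at xs (suc k)

OpenPos : {A : Set} → Tree A → Path → ℕ → Set
OpenPos {A} s v k = Σ A (λ x → at (XML s) k ≡ just (opn v x))

ClosePos : {A : Set} → Tree A → Path → ℕ → Set
ClosePos {A} s v k = Σ A (λ x → at (XML s) k ≡ just (cls v x))

-- In XML(s) every tag strictly between the two tags of a node v belongs to a
-- descendant of v, and every node closes exactly once.  If the parents p and p′
-- both open before i and close after j, while the closing tags of their left
-- children lie in [i, j], then the closing tag of p·L lies strictly inside p′,
-- so p′ is an ancestor of p·L.  It is not p·L itself, because p·L closes only
-- once, and so p′ is an ancestor of p.  By symmetry p = p′, and the two closing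
-- tags coincide.
module Submission where

open import Defs
open import Data.Nat using (ℕ; _≤_; _<_; zero; suc; _+_; z≤n; s≤s)
open import Data.Nat.Properties
  using (≤-trans; <-trans; ≤-<-trans; <-≤-trans; <-irrefl; <⇒≤; ≤⇒≯; m<m+n; +-cancelˡ-<)
open import Data.List using (List; []; _∷_; _++_; length; _∷ʳ_; [_])
open import Data.List.Relation.Unary.All using (All; []; _∷_) renaming (map to All-map)
open import Data.List.Relation.Unary.All.Properties using (++⁺)
open import Data.List.Relation.Binary.Pointwise as Pointwise using (Pointwise-≡⇒≡)
open import Data.List.Relation.Binary.Prefix.Heterogeneous using (Prefix; []; _∷_)
open import Data.List.Relation.Binary.Prefix.Heterogeneous.Properties as Prefix
  using (fromPointwise)
open import Data.Maybe using (just)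
open import Data.Product using (Σ; _×_; _,_; proj₂)
open import Data.Sum using (_⊎_; inj₁; inj₂)
open import Data.Empty using (⊥-elim)
open import Function using (_∘_)
open import Relation.Nullary using (¬_)
open import Relation.Binary.PropositionalEquality as ≡ using (_≡_; refl; cong; subst)

_⊑_ : Path → Path → Set
_⊑_ = Prefix _≡_

⊑-refl : ∀ {v} → v ⊑ v
⊑-refl = fromPointwise (Pointwise.refl refl)

⊑-trans : ∀ {u v w} → u ⊑ v → v ⊑ w → u ⊑ w
⊑-trans = Prefix.trans ≡.trans

⊑-antisym : ∀ {u v} → u ⊑ v → v ⊑ u → u ≡ v
⊑-antisym u⊑v v⊑u = Pointwise-≡⇒≡ (Prefix.antisym (λ e _ → e) u⊑v v⊑u)

⊑-∷ʳ : ∀ {π d} → π ⊑ (π ∷ʳ d)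
⊑-∷ʳ {[]} = []
⊑-∷ʳ {e ∷ π} = refl ∷ ⊑-∷ʳ

∷ʳ-⋢ : ∀ {π d} → ¬ (π ∷ʳ d) ⊑ π
∷ʳ-⋢ {[]} ()
∷ʳ-⋢ {e ∷ π} (refl ∷ h) = ∷ʳ-⋢ h

∷ʳR⊑⇒∷ʳL⋢ : ∀ {π w} → (π ∷ʳ R) ⊑ w → ¬ (π ∷ʳ L) ⊑ w
∷ʳR⊑⇒∷ʳL⋢ {[]} (refl ∷ _) (() ∷ _)
∷ʳR⊑⇒∷ʳL⋢ {e ∷ π} (refl ∷ h) (refl ∷ g) = ∷ʳR⊑⇒∷ʳL⋢ {π} h g

⊑-∷ʳ⁻ : ∀ {v} π {d} → v ⊑ (π ∷ʳ d) → v ⊑ π ⊎ v ≡ π ∷ʳ d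
⊑-∷ʳ⁻ [] [] = inj₁ []
⊑-∷ʳ⁻ [] (refl ∷ []) = inj₂ refl
⊑-∷ʳ⁻ (e ∷ π) [] = inj₁ []
⊑-∷ʳ⁻ (e ∷ π) (refl ∷ h) with ⊑-∷ʳ⁻ π h
... | inj₁ g = inj₁ (refl ∷ g)
... | inj₂ eq = inj₂ (cong (e ∷_) eq)

module _ {B : Set} where

  at-++ : ∀ (xs ys : List B) k {t} → at (xs ++ ys) k ≡ just t →
    (k ≤ length xs × at xs k ≡ just t) ⊎ Σ ℕ (λ k′ → k ≡ length xs + k′ × at ys k′ ≡ just t)
  at-++ [] ys k e = inj₂ (k , refl , e)
  at-++ (x ∷ xs) ys (suc zero) e = inj₁ (s≤s z≤n , e)
  at-++ (x ∷ xs) ys (suc (suc k)) e with at-++ xs ys (suc k) e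
  ... | inj₁ (k≤ , e′) = inj₁ (s≤s k≤ , e′)
  ... | inj₂ (k′ , eq , e′) = inj₂ (k′ , cong suc eq , e′)

  at-positive : ∀ (xs : List B) k {t} → at xs k ≡ just t → 1 ≤ k
  at-positive (x ∷ xs) (suc k) e = s≤s z≤n

  at-All : ∀ {P : B → Set} {xs} k {t} → All P xs → at xs k ≡ just t → P t
  at-All (suc zero) (px ∷ _) refl = px
  at-All (suc (suc k)) (_ ∷ pxs) e = at-All (suc k) pxs e

module _ {A : Set} where

  tpath : Tag A → Path
  tpath (opn v _) = v
  tpath (cls v _) = v

  Below : Path → Tag A → Set
  Below v t = v ⊑ tpath t

  ClosingUnique : List (Tag A) → Set
  ClosingUnique X = ∀ k k′ {v x y} → at X k ≡ just (cls v x) → at X k′ ≡ just (cls v y) → k ≡ k′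

  Nested : List (Tag A) → Set
  Nested X = ∀ a b c {v x y t} → at X a ≡ just (opn v x) → at X b ≡ just (cls v y) →
    a < c → c < b → at X c ≡ just t → Below v t

  NestedAcross : List (Tag A) → List (Tag A) → Set
  NestedAcross xs ys = ∀ a b {v x y} → at xs a ≡ just (opn v x) → at ys b ≡ just (cls v y) →
    All (Below v) (xs ++ ys)

  Apart : List (Tag A) → List (Tag A) → Set
  Apart xs ys = ∀ k k′ {t u} → at xs k ≡ just t → at ys k′ ≡ just u → ¬ tpath t ≡ tpath u

  Apart-separated : ∀ {w xs ys} → All (Below w) xs → All (¬_ ∘ Below w) ys → Apart xs ys
  Apart-separated below notBelow k k′ e e′ eq =
    at-All k′ notBelow e′ (subst (_ ⊑_) eq (at-All k below e))

  NoSharedClosing : List (Tag A) → List (Tag A) → Set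
  NoSharedClosing xs ys = ∀ k k′ {v x y} → at xs k ≡ just (cls v x) → ¬ at ys k′ ≡ just (cls v y)

  Apart⇒NoSharedClosing : ∀ xs ys → Apart xs ys → NoSharedClosing xs ys
  Apart⇒NoSharedClosing _ _ apart k k′ e e′ = apart k k′ e e′ refl

  Apart⇒NestedAcross : ∀ xs ys → Apart xs ys → NestedAcross xs ys
  Apart⇒NestedAcross _ _ apart a b e e′ = ⊥-elim (apart a b e e′ refl)

  ClosingUnique-++ : ∀ xs ys → ClosingUnique xs → ClosingUnique ys → NoSharedClosing xs ys →
    ClosingUnique (xs ++ ys)
  ClosingUnique-++ xs ys uxs uys disjoint k k′ e e′ with at-++ xs ys k e | at-++ xs ys k′ e′
  ... | inj₁ (_ , a) | inj₁ (_ , b) = uxs k k′ a b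
  ... | inj₁ (_ , a) | inj₂ (m , _ , b) = ⊥-elim (disjoint k m a b)
  ... | inj₂ (m , _ , a) | inj₁ (_ , b) = ⊥-elim (disjoint k′ m b a)
  ... | inj₂ (m , refl , a) | inj₂ (m′ , refl , b) = cong (length xs +_) (uys m m′ a b)

  -- Besides pairs inside xs or inside ys, only a node opened in xs and closed in ys
  -- can enclose a tag; every other placement of a < c < b contradicts the order.
  Nested-++ : ∀ xs ys → Nested xs → Nested ys → NestedAcross xs ys → Nested (xs ++ ys)
  Nested-++ xs ys nxs nys across a b c ea eb a<c c<b ec
    with at-++ xs ys a ea | at-++ xs ys b eb | at-++ xs ys c ec
  ... | inj₁ (_ , a′) | inj₁ (_ , b′) | inj₁ (_ , c′) = nxs a b c a′ b′ a<c c<b c′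
  ... | inj₁ _ | inj₁ (b≤ , _) | inj₂ (m , refl , c′) =
        ⊥-elim (≤⇒≯ (≤-trans (<⇒≤ c<b) b≤) (m<m+n (length xs) (at-positive ys m c′)))
  ... | inj₁ (_ , a′) | inj₂ (m , _ , b′) | _ = at-All c (across a m a′ b′) ec
  ... | inj₂ (m , refl , a′) | inj₁ (b≤ , _) | _ =
        ⊥-elim (≤⇒≯ b≤ (<-trans (m<m+n (length xs) (at-positive ys m a′)) (<-trans a<c c<b)))
  ... | inj₂ (m , refl , a′) | inj₂ _ | inj₁ (c≤ , _) =
        ⊥-elim (≤⇒≯ c≤ (<-trans (m<m+n (length xs) (at-positive ys m a′)) a<c))
  ... | inj₂ (m , refl , a′) | inj₂ (n , refl , b′) | inj₂ (o , refl , c′) =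
        nys m n o a′ b′ (+-cancelˡ-< (length xs) _ _ a<c) (+-cancelˡ-< (length xs) _ _ c<b) c′

module _ {A : Set} where

  XMLat-Below : ∀ π (t : Tree A) → All (Below π) (XMLat π t)
  XMLat-Below π leaf = []
  XMLat-Below π (node x l r) =
    ⊑-refl ∷ ++⁺ (All-map (⊑-trans ⊑-∷ʳ) (XMLat-Below (π ∷ʳ L) l))
                 (++⁺ (All-map (⊑-trans ⊑-∷ʳ) (XMLat-Below (π ∷ʳ R) r)) (⊑-refl ∷ []))

  left-apart : ∀ π x (l r : Tree A) → Apart (XMLat (π ∷ʳ L) l) (XMLat (π ∷ʳ R) r ++ [ cls π x ])
  left-apart π x l r = Apart-separated (XMLat-Below (π ∷ʳ L) l)
    (++⁺ (All-map ∷ʳR⊑⇒∷ʳL⋢ (XMLat-Below (π ∷ʳ R) r)) (∷ʳ-⋢ ∷ []))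

  right-apart : ∀ π x (r : Tree A) → Apart (XMLat (π ∷ʳ R) r) [ cls π x ]
  right-apart π x r = Apart-separated (XMLat-Below (π ∷ʳ R) r) (∷ʳ-⋢ ∷ [])

  XMLat-ClosingUnique : ∀ π (t : Tree A) → ClosingUnique (XMLat π t)
  XMLat-ClosingUnique π leaf (suc _) _ ()
  XMLat-ClosingUnique π (node x l r) =
    ClosingUnique-++ [ opn π x ] (Lx ++ (Rx ++ [ cls π x ])) opening-only
      (ClosingUnique-++ Lx (Rx ++ [ cls π x ]) (XMLat-ClosingUnique _ l)
        (ClosingUnique-++ Rx [ cls π x ] (XMLat-ClosingUnique _ r) closing-once
          (Apart⇒NoSharedClosing Rx [ cls π x ] (right-apart π x r)))
        (Apart⇒NoSharedClosing Lx (Rx ++ [ cls π x ]) (left-apart π x l r)))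
      no-closing
    where
    Lx = XMLat (π ∷ʳ L) l
    Rx = XMLat (π ∷ʳ R) r
    opening-only : ClosingUnique [ opn π x ]
    opening-only (suc zero) _ ()
    no-closing : NoSharedClosing [ opn π x ] (Lx ++ (Rx ++ [ cls π x ]))
    no-closing (suc zero) _ ()
    closing-once : ClosingUnique [ cls π x ]
    closing-once (suc zero) (suc zero) refl refl = refl

  XMLat-Nested : ∀ π (t : Tree A) → Nested (XMLat π t)
  XMLat-Nested π leaf (suc _) _ _ ()
  XMLat-Nested π (node x l r) =
    Nested-++ [ opn π x ] (Lx ++ (Rx ++ [ cls π x ])) opening-only
      (Nested-++ Lx (Rx ++ [ cls π x ]) (XMLat-Nested _ l)
        (Nested-++ Rx [ cls π x ] (XMLat-Nested _ r) closing-only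
          (Apart⇒NestedAcross Rx [ cls π x ] (right-apart π x r)))
        (Apart⇒NestedAcross Lx (Rx ++ [ cls π x ]) (left-apart π x l r)))
      root-across
    where
    Lx = XMLat (π ∷ʳ L) l
    Rx = XMLat (π ∷ʳ R) r
    opening-only : Nested [ opn π x ]
    opening-only _ (suc zero) _ _ ()
    closing-only : Nested [ cls π x ]
    closing-only (suc zero) _ _ ()
    root-across : NestedAcross [ opn π x ] (Lx ++ (Rx ++ [ cls π x ]))
    root-across (suc zero) _ refl _ = XMLat-Below π (node x l r)

enclosing-∷ʳL-closing⇒⊑ : ∀ {A} (s : Tree A) p {p′ op′ cp′ ka} →
  OpenPos s p′ op′ → ClosePos s p′ cp′ → ClosePos s (p ∷ʳ L) ka →
  op′ < ka → ka < cp′ → p′ ⊑ p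
enclosing-∷ʳL-closing⇒⊑ s p {op′ = op′} {cp′} {ka} (_ , o) (_ , c) (_ , k) op′<ka ka<cp′
  with ⊑-∷ʳ⁻ p (XMLat-Nested [] s op′ cp′ ka o c op′<ka ka<cp′ k)
... | inj₁ p′⊑p = p′⊑p
... | inj₂ refl = ⊥-elim (<-irrefl (XMLat-ClosingUnique [] s ka cp′ k c) ka<cp′)

lemma6 : {A : Set} (s : Tree A) (i j : ℕ) → 1 ≤ i → i ≤ j → j ≤ length (XML s) →
    (p p' : Path) (ka op cp ka' op' cp' : ℕ) →
    OpenPos s p op → ClosePos s p cp → ClosePos s (p ∷ʳ L) ka →
    op < i → i ≤ ka → ka ≤ j → j < cp →
    OpenPos s p' op' → ClosePos s p' cp' → ClosePos s (p' ∷ʳ L) ka' →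
    op' < i → i ≤ ka' → ka' ≤ j → j < cp' →
    ka ≡ ka'
lemma6 s i j _ _ _ p p′ ka op cp ka′ op′ cp′ o c k op<i i≤ka ka≤j j<cp
  o′ c′ k′ op′<i i≤ka′ ka′≤j j<cp′
  with ⊑-antisym (enclosing-∷ʳL-closing⇒⊑ s p o′ c′ k (<-≤-trans op′<i i≤ka) (≤-<-trans ka≤j j<cp′))
                 (enclosing-∷ʳL-closing⇒⊑ s p′ o c k′ (<-≤-trans op<i i≤ka′) (≤-<-trans ka′≤j j<cp))
... | refl = XMLat-ClosingUnique [] s ka ka′ (proj₂ k) (proj₂ k′)
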